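{- Let $X$ be a set of symbols and $P,Q,R,S,T\subseteq\mathbb{Q}[X]$ finite sets of polynomials, and let \[ F=\Big(\bigwedge_{p\in P}0\le p\Big)\land\Big(\bigwedge_{q\in Q}\lnot(0\le q)\Big)\land\Big(\bigwedge_{r\in R}\lnot(0=r)\Big)\land\Big(\bigwedge_{s\in S}\mathit{Int}(s)\Big)\land\Big(\bigwedge_{t\in T}\lnot\mathit{Int}(t)\Big). \] Let $B=S\cup\{1\}$, and let $C$ be the least regular cone that contains $P$ and is closed under cutting planes with respect to $\mathrm{units}(C)+\mathbb{Z}\langle B\rangle$. Then $F$ is satisfiable modulo $\mathbf{LIRR}$ if and only if $C$ is consistent and $\mathfrak{M}(C,\mathrm{units}(C)+\mathbb{Z}\langle B\rangle)\models F$.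
   Context: $\mathbb{Z}\langle B\rangle$ is the set of integer linear combinations of elements of $B$. A cone in $\mathbb{Q}[X]$ contains $0$ and is closed under addition and non-negative rational scaling; $\mathrm{units}(C)=\{p:p\in C,-p\in C\}$; $C$ is regular if $1\in C$ and $\mathrm{units}(C)$ is an ideal; consistent if $C\ne\mathbb{Q}[X]$. $C$ is closed under cutting planes w.r.t. $L$ if for all $a,b\in\mathbb{Z}$, $a>0$, $p\in L$: $ap+b\in C\Rightarrow p+\lfloor b/a\rfloor\in C$. $\sigma^Z_{or}$ is the ordered-ring signature ($+,\cdot,0,1,=,\le$) plus a unary predicate $\mathit{Int}$; rational-coefficient atoms abbreviate atoms obtained by clearing denominators. For a regular cone $C$ and $L=\mathrm{units}(C)+L_0$ with $L_0$ a point lattice, $\mathfrak{M}(C,L)$ is the $\sigma^Z_{or}(X)$-structure with universe and ring operations of $\mathbb{Q}[X]/I$, $I=\mathrm{units}(C)$, $x\mapsto x+I$, $\le$ as $\{(p+I,q+I):q-p\in C\}$, and $\mathit{Int}$ as $\{p+I:p\in L\}$. $\mathbf{LIRR}$ is axiomatized by: the commutative ring axioms; reflexivity, transitivity, antisymmetry of $\le$; $\forall x,y,z\,(x\le y\Rightarrow x+z\le y+z)$; $0\le1\land0\ne1$; for each integer $n\ge1$, $\exists x\,(x+\dots+x=1)$; for each integer $n\ge1$, $\forall x\,(0\le x+\dots+x\Rightarrow0\le x)$ ($n$ summands); $\mathit{Int}(1)$; $\forall x,y\,(\mathit{Int}(x)\land\mathit{Int}(y)\Rightarrow\mathit{Int}(x+y))$;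 $\forall x,y\,(\mathit{Int}(x)\land x+y=0\Rightarrow\mathit{Int}(y))$; for all integers $n>0$, $m$: $\forall x\,(\mathit{Int}(x)\land0\le nx+m\Rightarrow0\le x+\lfloor m/n\rfloor)$. -}

module Defs where

open import Level using (Level; 0ℓ) renaming (suc to lsuc)
open import Data.Nat as ℕ using (ℕ; zero; suc)
open import Data.Integer as ℤ using (ℤ; +_; -[1+_])
open import Data.Rational as ℚ using (ℚ; mkℚ; 0ℚ; 1ℚ; floor)
open import Data.List using (List; _∷_; [])
open import Data.List.Membership.Propositional using (_∈_)
open import Data.List.Relation.Unary.All using (All)
open import Data.Product using (Σ; _×_; ∃; ∃-syntax)
open import Relation.Nullary using (¬_)
open import Algebra.Structures using (IsCommutativeRing)

-- ℚ[X] : polynomial expressions over ℚ in the symbols X, modulo the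
-- least congruence making them the free commutative ℚ-algebra on X.

infixl 6 _⊕_
infixl 7 _⊗_

data Poly (X : Set) : Set where
  con  : ℚ → Poly X
  var  : X → Poly X
  _⊕_  : Poly X → Poly X → Poly X
  _⊗_  : Poly X → Poly X → Poly X
  ⊝_   : Poly X → Poly X

module _ {X : Set} where

  cℤ : ℤ → Poly X
  cℤ k = con (k ℚ./ 1)

  𝟘 𝟙 : Poly X
  𝟘 = con 0ℚ
  𝟙 = con 1ℚ

  infix 4 _≈ₚ_
  data _≈ₚ_ : Poly X → Poly X → Set where
    ≈refl  : ∀ {p} → p ≈ₚ p
    ≈sym   : ∀ {p q} → p ≈ₚ q → q ≈ₚ p
    ≈trans : ∀ {p q r} → p ≈ₚ q → q ≈ₚ r → p ≈ₚ r
    ⊕-cong : ∀ {p p′ q q′} → p ≈ₚ p′ → q ≈ₚ q′ → p ⊕ q ≈ₚ p′ ⊕ q′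
    ⊗-cong : ∀ {p p′ q q′} → p ≈ₚ p′ → q ≈ₚ q′ → p ⊗ q ≈ₚ p′ ⊗ q′
    ⊝-cong : ∀ {p p′} → p ≈ₚ p′ → ⊝ p ≈ₚ ⊝ p′
    ⊕-assoc : ∀ p q r → (p ⊕ q) ⊕ r ≈ₚ p ⊕ (q ⊕ r)
    ⊕-comm  : ∀ p q → p ⊕ q ≈ₚ q ⊕ p
    ⊕-idˡ   : ∀ p → 𝟘 ⊕ p ≈ₚ p
    ⊕-invʳ  : ∀ p → p ⊕ (⊝ p) ≈ₚ 𝟘
    ⊗-assoc : ∀ p q r → (p ⊗ q) ⊗ r ≈ₚ p ⊗ (q ⊗ r)
    ⊗-comm  : ∀ p q → p ⊗ q ≈ₚ q ⊗ p
    ⊗-idˡ   : ∀ p → 𝟙 ⊗ p ≈ₚ p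
    distribˡ : ∀ p q r → p ⊗ (q ⊕ r) ≈ₚ (p ⊗ q) ⊕ (p ⊗ r)
    con-+   : ∀ a b → con (a ℚ.+ b) ≈ₚ con a ⊕ con b
    con-*   : ∀ a b → con (a ℚ.* b) ≈ₚ con a ⊗ con b

  infixl 6 _⊖_
  _⊖_ : Poly X → Poly X → Poly X
  p ⊖ q = p ⊕ (⊝ q)

  PolySet : Set₁
  PolySet = Poly X → Set

  Respects≈ : PolySet → Set
  Respects≈ C = ∀ {p q} → p ≈ₚ q → C p → C q

  record IsCone (C : PolySet) : Set where
    field
      resp  : Respects≈ C
      zero∈ : C 𝟘
      add   : ∀ {p q} → C p → C q → C (p ⊕ q)
      scale : ∀ (c : ℚ) {p} → 0ℚ ℚ.≤ c → C p → C (con c ⊗ p)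

  units : PolySet → PolySet
  units C p = C p × C (⊝ p)

  record IsIdeal (I : PolySet) : Set where
    field
      resp  : Respects≈ I
      zero∈ : I 𝟘
      add   : ∀ {p q} → I p → I q → I (p ⊕ q)
      neg   : ∀ {p} → I p → I (⊝ p)
      mul   : ∀ q {p} → I p → I (q ⊗ p)

  record IsRegular (C : PolySet) : Set where
    field
      isCone    : IsCone C
      one∈      : C 𝟙
      unitsIdeal : IsIdeal (units C)

  Consistent : PolySet → Set
  Consistent C = ¬ (∀ p → C p)

  data ℤSpan (B : List (Poly X)) : Poly X → Set where
    zero : ℤSpan B 𝟘
    step : ∀ {b p} (k : ℤ) → b ∈ B → ℤSpan B p → ℤSpan B (cℤ k ⊗ b ⊕ p)

  unitsPlusSpan : PolySet → List (Poly X) → PolySet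
  unitsPlusSpan C B p = ∃[ u ] ∃[ v ] (units C u × ℤSpan B v × p ≈ₚ u ⊕ v)

  -- closure under cutting planes w.r.t. L  (a = suc k ranges over a > 0)
  ClosedCP : PolySet → PolySet → Set
  ClosedCP C L = ∀ (k : ℕ) (b : ℤ) (p : Poly X) → L p →
    C (cℤ (+ suc k) ⊗ p ⊕ cℤ b) → C (p ⊕ cℤ (floor (b ℚ./ suc k)))

  AdmissibleCone : List (Poly X) → List (Poly X) → PolySet → Set
  AdmissibleCone P B C =
    IsRegular C × All C P × ClosedCP C (unitsPlusSpan C B)

  IsLeastCone : List (Poly X) → List (Poly X) → PolySet → Set₁
  IsLeastCone P B C =
    AdmissibleCone P B C ×
    (∀ (C′ : PolySet) → AdmissibleCone P B C′ → ∀ p → C p → C′ p)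

-- σ^Z_or-structures (equality interpreted by a relation _≈_, which the
-- LIRR axioms require to be a congruence; negation and the inverses
-- 1/n are Skolem functions for the corresponding ∃-axioms).

record Structure : Set₁ where
  field
    Carrier : Set
    _≈_     : Carrier → Carrier → Set
    _+_     : Carrier → Carrier → Carrier
    _*_     : Carrier → Carrier → Carrier
    -_      : Carrier → Carrier
    0#      : Carrier
    1#      : Carrier
    _≤_     : Carrier → Carrier → Set
    Int     : Carrier → Set
    inv     : ℕ → Carrier     -- inv n is a witness of ∃x. (n+1)·x = 1

  -- sumN n x = x + ... + x  with (n+1) summands
  sumN : ℕ → Carrier → Carrier
  sumN zero    x = x
  sumN (suc n) x = x + sumN n x

  natC : ℕ → Carrier
  natC zero    = 0#
  natC (suc n) = 1# + natC n

  intC : ℤ → Carrier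
  intC (+ n)    = natC n
  intC -[1+ n ] = - natC (suc n)

  ratC : ℚ → Carrier
  ratC (mkℚ a d-1 _) = intC a * inv d-1

  eval : {X : Set} → (X → Carrier) → Poly X → Carrier
  eval ρ (con q) = ratC q
  eval ρ (var x) = ρ x
  eval ρ (p ⊕ q) = eval ρ p + eval ρ q
  eval ρ (p ⊗ q) = eval ρ p * eval ρ q
  eval ρ (⊝ p)   = - eval ρ p

record IsLIRR (𝔄 : Structure) : Set where
  open Structure 𝔄
  field
    isCommutativeRing : IsCommutativeRing _≈_ _+_ _*_ -_ 0# 1#
    ≤-respˡ : ∀ {x x′ y} → x ≈ x′ → x ≤ y → x′ ≤ y
    ≤-respʳ : ∀ {x y y′} → y ≈ y′ → x ≤ y → x ≤ y′
    Int-resp : ∀ {x x′} → x ≈ x′ → Int x → Int x′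
    ≤-refl   : ∀ x → x ≤ x
    ≤-trans  : ∀ {x y z} → x ≤ y → y ≤ z → x ≤ z
    ≤-antisym : ∀ {x y} → x ≤ y → y ≤ x → x ≈ y
    ≤-+      : ∀ {x y} z → x ≤ y → (x + z) ≤ (y + z)
    0≤1      : 0# ≤ 1#
    0≉1      : ¬ (0# ≈ 1#)
    inv-spec : ∀ n → sumN n (inv n) ≈ 1#
    div-pos  : ∀ n x → 0# ≤ sumN n x → 0# ≤ x
    Int-1    : Int 1#
    Int-+    : ∀ {x y} → Int x → Int y → Int (x + y)
    Int-neg  : ∀ {x y} → Int x → (x + y) ≈ 0# → Int y
    Int-cut  : ∀ (k : ℕ) (m : ℤ) x → Int x → 0# ≤ (sumN k x + intC m) →
               0# ≤ (x + intC (floor (m ℚ./ suc k)))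

record Formula (X : Set) : Set where
  constructor mkF
  field
    P Q R S T : List (Poly X)

module _ {X : Set} where
  open Formula

  _,_⊨_ : (𝔄 : Structure) → (X → Structure.Carrier 𝔄) → Formula X → Set
  𝔄 , ρ ⊨ F =
    All (λ p → 0# ≤ ⟦ p ⟧) (P F) ×
    All (λ q → ¬ (0# ≤ ⟦ q ⟧)) (Q F) ×
    All (λ r → ¬ (0# ≈ ⟦ r ⟧)) (R F) ×
    All (λ s → Int ⟦ s ⟧) (S F) ×
    All (λ t → ¬ Int ⟦ t ⟧) (T F)
    where
      open Structure 𝔄
      ⟦_⟧ = eval ρ

  SatisfiableLIRR : Formula X → Set₁
  SatisfiableLIRR F =
    Σ Structure λ 𝔄 → IsLIRR 𝔄 × Σ (X → Structure.Carrier 𝔄) λ ρ → 𝔄 , ρ ⊨ F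

  -- 𝔐(C, L): universe ℚ[X]/units(C) (as a setoid)
  𝔐 : PolySet → PolySet → Structure
  𝔐 C L = record
    { Carrier = Poly X
    ; _≈_ = λ p q → units C (p ⊖ q)
    ; _+_ = _⊕_
    ; _*_ = _⊗_
    ; -_ = ⊝_
    ; 0# = 𝟘
    ; 1# = 𝟙
    ; _≤_ = λ p q → C (q ⊖ p)
    ; Int = λ p → ∃[ p′ ] (L p′ × units C (p ⊖ p′))
    ; inv = λ n → con (+ 1 ℚ./ suc n)
    }

module Submission where

-- If ρ satisfies F in a model 𝔄 of LIRR, then C⁺ = {p | 0 ≤ ⟦p⟧} is a regular cone containing P, and it
-- is closed under cutting planes w.r.t. units(C⁺) + ℤ⟨1, S⟩ because every element of that lattice evaluates
-- to an integer of 𝔄, where the cutting-plane axiom holds. By minimality C ⊆ C⁺, so C is consistent (0 ≠ 1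
-- in 𝔄), and F holds in 𝔐(C, L) at x ↦ x: the positive literals because P ⊆ C and S ⊆ L, the negative
-- ones because every atom true in 𝔐 at a polynomial p is true in 𝔄 at ⟦p⟧.
-- Conversely 𝔐(C, L) is itself a model of LIRR: ℚ[X]/units(C) is a commutative ring ordered by C,
-- consistency of C is 0 ≠ 1, and the cutting-plane axiom is exactly the cutting-plane closure of C.

open import Level using (0ℓ)
open import Defs renaming (distribˡ to ⊗-distribˡ-⊕)
open import Data.Nat as ℕ using (ℕ; zero; suc)
import Data.Nat.Properties as ℕP
open import Data.Integer as ℤ using (ℤ; +_; -[1+_])
import Data.Integer.Properties as ℤP
import Data.Rational as ℚ
import Data.Rational.Properties as ℚP
import Data.Rational.Unnormalised as ℚᵘ
import Data.Rational.Unnormalised.Properties as ℚᵘP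
open import Data.Maybe using (just; nothing)
open import Data.Unit using (⊤)
open import Data.Product using (_×_; _,_; proj₁; proj₂; ∃-syntax)
open import Data.List using (List; _∷_)
open import Data.List.Membership.Propositional using (_∈_)
open import Data.List.Relation.Unary.Any using (here; there)
open import Data.List.Relation.Unary.All as All using (All)
open import Function.Bundles using (_⇔_; mk⇔; Equivalence)
open import Relation.Nullary using (yes; no)
open import Relation.Binary.PropositionalEquality as ≡ using (_≡_)
open import Relation.Binary.Definitions using (WeaklyDecidable)
open import Algebra.Structures using (IsCommutativeRing)
open import Algebra.Bundles using (CommutativeRing)
import Algebra.Solver.Ring.AlmostCommutativeRing as ACR
import Algebra.Solver.Ring as RingSolver
import Algebra.Properties.Ring as RingProperties
import Algebra.Properties.CommutativeSemigroup as CommSemigroupProperties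
import Relation.Binary.Reasoning.Setoid as SetoidReasoning

-- Rational constants in a commutative ring with inverses of the positive integers

IsRingStructure : Structure → Set
IsRingStructure 𝔄 = IsCommutativeRing _≈_ _+_ _*_ -_ 0# 1#
  where open Structure 𝔄

module Numerals (𝔄 : Structure) (isCR : IsRingStructure 𝔄) where
  open Structure 𝔄 using (natC; intC; sumN)

  commutativeRing : CommutativeRing 0ℓ 0ℓ
  commutativeRing = record { isCommutativeRing = isCR }

  open CommutativeRing commutativeRing public
  open RingProperties ring public
  open CommSemigroupProperties +-commutativeSemigroup using (x∙yz≈y∙xz)
  open SetoidReasoning setoid public

  natC-homo-+ : ∀ m n → natC (m ℕ.+ n) ≈ natC m + natC n
  natC-homo-+ zero    n = sym (+-identityˡ _)
  natC-homo-+ (suc m) n = trans (+-congˡ (natC-homo-+ m n)) (sym (+-assoc _ _ _))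

  natC-homo-* : ∀ m n → natC (m ℕ.* n) ≈ natC m * natC n
  natC-homo-* zero    n = sym (zeroˡ _)
  natC-homo-* (suc m) n = begin
    natC (n ℕ.+ m ℕ.* n)             ≈⟨ natC-homo-+ n (m ℕ.* n) ⟩
    natC n + natC (m ℕ.* n)          ≈⟨ +-cong (sym (*-identityˡ _)) (natC-homo-* m n) ⟩
    1# * natC n + natC m * natC n    ≈⟨ distribʳ _ _ _ ⟨
    (1# + natC m) * natC n           ∎

  intC-homo-neg : ∀ z → intC (ℤ.- z) ≈ - intC z
  intC-homo-neg (+ zero)  = sym -0#≈0#
  intC-homo-neg (+ suc n) = refl
  intC-homo-neg -[1+ n ]  = sym (-‿involutive _)

  intC-⊖ : ∀ m n → intC (m ℤ.⊖ n) ≈ natC m - natC n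
  intC-⊖ zero    zero    = sym (-‿inverseʳ _)
  intC-⊖ zero    (suc n) = sym (+-identityˡ _)
  intC-⊖ (suc m) zero    = sym (trans (+-congˡ -0#≈0#) (+-identityʳ _))
  intC-⊖ (suc m) (suc n) = begin
    intC (suc m ℤ.⊖ suc n)              ≡⟨ ≡.cong intC (ℤP.[1+m]⊖[1+n]≡m⊖n m n) ⟩
    intC (m ℤ.⊖ n)                      ≈⟨ intC-⊖ m n ⟩
    natC m - natC n                     ≈⟨ sym (x+y-x+z≈y-z 1# (natC m) (natC n)) ⟩
    (1# + natC m) - (1# + natC n)       ∎
    where
    x+y-x+z≈y-z : ∀ x y z → (x + y) - (x + z) ≈ y - z
    x+y-x+z≈y-z x y z = begin
      (x + y) - (x + z)        ≈⟨ +-congˡ (sym (-‿+-comm x z)) ⟩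
      (x + y) + (- x + - z)    ≈⟨ +-assoc x y _ ⟩
      x + (y + (- x + - z))    ≈⟨ +-congˡ (x∙yz≈y∙xz y (- x) (- z)) ⟩
      x + (- x + (y + - z))    ≈⟨ +-assoc x (- x) _ ⟨
      (x + - x) + (y - z)      ≈⟨ +-congʳ (-‿inverseʳ x) ⟩
      0# + (y - z)             ≈⟨ +-identityˡ _ ⟩
      y - z                    ∎

  intC-homo-+ : ∀ x y → intC (x ℤ.+ y) ≈ intC x + intC y
  intC-homo-+ (+ m)    (+ n)    = natC-homo-+ m n
  intC-homo-+ (+ m)    -[1+ n ] = intC-⊖ m (suc n)
  intC-homo-+ -[1+ m ] (+ n)    = trans (intC-⊖ n (suc m)) (+-comm _ _)
  intC-homo-+ -[1+ m ] -[1+ n ] = begin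
    - natC (suc (suc (m ℕ.+ n)))        ≡⟨ ≡.cong (λ k → - natC k) (ℕP.+-suc (suc m) n) ⟨
    - natC (suc m ℕ.+ suc n)            ≈⟨ -‿cong (natC-homo-+ (suc m) (suc n)) ⟩
    - (natC (suc m) + natC (suc n))     ≈⟨ -‿+-comm _ _ ⟨
    - natC (suc m) + - natC (suc n)     ∎

  intC-homo-*-natC : ∀ z n → intC (z ℤ.* + n) ≈ intC z * natC n
  intC-homo-*-natC z zero    = trans (reflexive (≡.cong intC (ℤP.*-zeroʳ z))) (sym (zeroʳ _))
  intC-homo-*-natC z (suc n) = begin
    intC (z ℤ.* + suc n)                ≡⟨ ≡.cong intC (ℤP.*-suc z (+ n)) ⟩
    intC (z ℤ.+ z ℤ.* + n)              ≈⟨ intC-homo-+ z (z ℤ.* + n) ⟩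
    intC z + intC (z ℤ.* + n)           ≈⟨ +-cong (sym (*-identityʳ _)) (intC-homo-*-natC z n) ⟩
    intC z * 1# + intC z * natC n       ≈⟨ distribˡ _ _ _ ⟨
    intC z * (1# + natC n)              ∎

  intC-homo-* : ∀ x y → intC (x ℤ.* y) ≈ intC x * intC y
  intC-homo-* x (+ n)    = intC-homo-*-natC x n
  intC-homo-* x -[1+ n ] = begin
    intC (x ℤ.* -[1+ n ])               ≡⟨ ≡.cong intC (ℤP.neg-distribʳ-* x (+ suc n)) ⟨
    intC (ℤ.- (x ℤ.* + suc n))          ≈⟨ intC-homo-neg (x ℤ.* + suc n) ⟩
    - intC (x ℤ.* + suc n)              ≈⟨ -‿cong (intC-homo-*-natC x (suc n)) ⟩
    - (intC x * natC (suc n))           ≈⟨ -‿distribʳ-* _ _ ⟩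
    intC x * - natC (suc n)             ∎

  intC-morphism : ℤ.+-*-rawRing ACR.-Raw-AlmostCommutative⟶ ACR.fromCommutativeRing commutativeRing
  intC-morphism = record
    { ⟦_⟧    = intC
    ; +-homo = intC-homo-+
    ; *-homo = intC-homo-*
    ; -‿homo = intC-homo-neg
    ; 0-homo = refl
    ; 1-homo = +-identityʳ 1#
    }

  _≟ℤ_ : WeaklyDecidable (ACR.Induced-equivalence intC-morphism)
  x ≟ℤ y with x ℤ.≟ y
  ... | yes ≡.refl = just refl
  ... | no _       = nothing

  open RingSolver ℤ.+-*-rawRing (ACR.fromCommutativeRing commutativeRing) intC-morphism _≟ℤ_ public
    using (solve; _:=_; _:+_; _:*_; :-_)

  sumN≈natC* : ∀ k x → sumN k x ≈ natC (suc k) * x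
  sumN≈natC* zero    x = sym (trans (*-congʳ (+-identityʳ 1#)) (*-identityˡ x))
  sumN≈natC* (suc k) x = begin
    x + sumN k x                        ≈⟨ +-cong (sym (*-identityˡ x)) (sumN≈natC* k x) ⟩
    1# * x + natC (suc k) * x           ≈⟨ distribʳ _ _ _ ⟨
    (1# + natC (suc k)) * x             ∎

module Rationals (𝔄 : Structure) (isCR : IsRingStructure 𝔄)
  (inv-spec : ∀ n → Structure._≈_ 𝔄 (Structure.sumN 𝔄 n (Structure.inv 𝔄 n)) (Structure.1# 𝔄))
  where
  open Structure 𝔄 using (natC; intC; ratC; inv; eval)
  open Numerals 𝔄 isCR public
  open CommSemigroupProperties *-commutativeSemigroup using (x∙yz≈yx∙z)

  natC*inv≈1 : ∀ k → natC (suc k) * inv k ≈ 1#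
  natC*inv≈1 k = trans (sym (sumN≈natC* k (inv k))) (inv-spec k)

  natC-cancelˡ : ∀ k {x y} → natC (suc k) * x ≈ natC (suc k) * y → x ≈ y
  natC-cancelˡ k {x} {y} eq = begin
    x                              ≈⟨ divide x ⟩
    (natC (suc k) * x) * inv k     ≈⟨ *-congʳ eq ⟩
    (natC (suc k) * y) * inv k     ≈⟨ divide y ⟨
    y                              ∎
    where
    divide : ∀ x → x ≈ (natC (suc k) * x) * inv k
    divide x = begin
      x                              ≈⟨ *-identityʳ x ⟨
      x * 1#                         ≈⟨ *-congˡ (natC*inv≈1 k) ⟨
      x * (natC (suc k) * inv k)     ≈⟨ x∙yz≈yx∙z x _ _ ⟩
      (natC (suc k) * x) * inv k     ∎

  natC*ratC≈intC : ∀ q m k → ℚ.toℚᵘ q ℚᵘ.≃ ℚᵘ.mkℚᵘ m k → natC (suc k) * ratC q ≈ intC m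
  natC*ratC≈intC (ℚ.mkℚ a d _) m k (ℚᵘ.*≡* eq) = begin
    natC (suc k) * (intC a * inv d)         ≈⟨ x∙yz≈yx∙z _ _ _ ⟩
    (intC a * natC (suc k)) * inv d         ≈⟨ *-congʳ (intC-homo-*-natC a (suc k)) ⟨
    intC (a ℤ.* + suc k) * inv d            ≡⟨ ≡.cong (λ w → intC w * inv d) eq ⟩
    intC (m ℤ.* + suc d) * inv d            ≈⟨ *-congʳ (intC-homo-*-natC m (suc d)) ⟩
    (intC m * natC (suc d)) * inv d         ≈⟨ *-assoc _ _ _ ⟩
    intC m * (natC (suc d) * inv d)         ≈⟨ *-congˡ (natC*inv≈1 d) ⟩
    intC m * 1#                             ≈⟨ *-identityʳ _ ⟩
    intC m                                  ∎

  ratC-homo-+ : ∀ p q → ratC (p ℚ.+ q) ≈ ratC p + ratC q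
  ratC-homo-+ p@(ℚ.mkℚ a₁ d₁ _) q@(ℚ.mkℚ a₂ d₂ _) =
    natC-cancelˡ (d₂ ℕ.+ d₁ ℕ.* suc d₂) (begin
      natC (suc d₁ ℕ.* suc d₂) * ratC (p ℚ.+ q)
        ≈⟨ natC*ratC≈intC (p ℚ.+ q) _ _ (ℚP.toℚᵘ-homo-+ p q) ⟩
      intC (a₁ ℤ.* + suc d₂ ℤ.+ a₂ ℤ.* + suc d₁)
        ≈⟨ intC-homo-+ (a₁ ℤ.* + suc d₂) (a₂ ℤ.* + suc d₁) ⟩
      intC (a₁ ℤ.* + suc d₂) + intC (a₂ ℤ.* + suc d₁)
        ≈⟨ +-cong (intC-homo-*-natC a₁ (suc d₂)) (intC-homo-*-natC a₂ (suc d₁)) ⟩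
      intC a₁ * n₂ + intC a₂ * n₁
        ≈⟨ +-cong (*-congʳ (natC*ratC≈intC p a₁ d₁ ℚᵘP.≃-refl)) (*-congʳ (natC*ratC≈intC q a₂ d₂ ℚᵘP.≃-refl)) ⟨
      (n₁ * ratC p) * n₂ + (n₂ * ratC q) * n₁
        ≈⟨ solve 4 (λ n₁ n₂ x y → (n₁ :* n₂) :* (x :+ y) := (n₁ :* x) :* n₂ :+ (n₂ :* y) :* n₁)
                 refl n₁ n₂ (ratC p) (ratC q) ⟨
      (n₁ * n₂) * (ratC p + ratC q)
        ≈⟨ *-congʳ (natC-homo-* (suc d₁) (suc d₂)) ⟨
      natC (suc d₁ ℕ.* suc d₂) * (ratC p + ratC q) ∎)
    where
    n₁ = natC (suc d₁)
    n₂ = natC (suc d₂)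

  ratC-homo-* : ∀ p q → ratC (p ℚ.* q) ≈ ratC p * ratC q
  ratC-homo-* p@(ℚ.mkℚ a₁ d₁ _) q@(ℚ.mkℚ a₂ d₂ _) =
    natC-cancelˡ (d₂ ℕ.+ d₁ ℕ.* suc d₂) (begin
      natC (suc d₁ ℕ.* suc d₂) * ratC (p ℚ.* q)
        ≈⟨ natC*ratC≈intC (p ℚ.* q) _ _ (ℚP.toℚᵘ-homo-* p q) ⟩
      intC (a₁ ℤ.* a₂)
        ≈⟨ intC-homo-* a₁ a₂ ⟩
      intC a₁ * intC a₂
        ≈⟨ *-cong (natC*ratC≈intC p a₁ d₁ ℚᵘP.≃-refl) (natC*ratC≈intC q a₂ d₂ ℚᵘP.≃-refl) ⟨
      (n₁ * ratC p) * (n₂ * ratC q)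
        ≈⟨ solve 4 (λ n₁ n₂ x y → (n₁ :* n₂) :* (x :* y) := (n₁ :* x) :* (n₂ :* y))
                 refl n₁ n₂ (ratC p) (ratC q) ⟨
      (n₁ * n₂) * (ratC p * ratC q)
        ≈⟨ *-congʳ (natC-homo-* (suc d₁) (suc d₂)) ⟨
      natC (suc d₁ ℕ.* suc d₂) * (ratC p * ratC q) ∎)
    where
    n₁ = natC (suc d₁)
    n₂ = natC (suc d₂)

  natC-1 : natC 1 ≈ 1#
  natC-1 = +-identityʳ 1#

  ratC-fromℤ : ∀ z → ratC (z ℚ./ 1) ≈ intC z
  ratC-fromℤ z = begin
    ratC (z ℚ./ 1)             ≈⟨ *-identityˡ _ ⟨
    1# * ratC (z ℚ./ 1)        ≈⟨ *-congʳ natC-1 ⟨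
    natC 1 * ratC (z ℚ./ 1)    ≈⟨ natC*ratC≈intC (z ℚ./ 1) z 0 (ℚP.toℚᵘ-fromℚᵘ (ℚᵘ.mkℚᵘ z 0)) ⟩
    intC z                     ∎

  ratC-0 : ratC ℚ.0ℚ ≈ 0#
  ratC-0 = zeroˡ _

  ratC-1 : ratC ℚ.1ℚ ≈ 1#
  ratC-1 = trans (*-congˡ (inv-spec 0)) (trans (*-identityʳ _) natC-1)

  eval-cong : ∀ {X : Set} (ρ : X → Structure.Carrier 𝔄) {p q : Poly X} → p ≈ₚ q → eval ρ p ≈ eval ρ q
  eval-cong ρ ≈refl                     = refl
  eval-cong ρ (≈sym e)                  = sym (eval-cong ρ e)
  eval-cong ρ (≈trans e f)              = trans (eval-cong ρ e) (eval-cong ρ f)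
  eval-cong ρ (⊕-cong e f)              = +-cong (eval-cong ρ e) (eval-cong ρ f)
  eval-cong ρ (⊗-cong e f)              = *-cong (eval-cong ρ e) (eval-cong ρ f)
  eval-cong ρ (⊝-cong e)                = -‿cong (eval-cong ρ e)
  eval-cong ρ (⊕-assoc p q r)           = +-assoc _ _ _
  eval-cong ρ (⊕-comm p q)              = +-comm _ _
  eval-cong ρ (⊕-idˡ p)                 = trans (+-congʳ ratC-0) (+-identityˡ _)
  eval-cong ρ (⊕-invʳ p)                = trans (-‿inverseʳ _) (sym ratC-0)
  eval-cong ρ (⊗-assoc p q r)           = *-assoc _ _ _
  eval-cong ρ (⊗-comm p q)              = *-comm _ _
  eval-cong ρ (⊗-idˡ p)                 = trans (*-congʳ ratC-1) (*-identityˡ _)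
  eval-cong ρ (⊗-distribˡ-⊕ p q r)      = distribˡ _ _ _
  eval-cong ρ (con-+ a b)               = ratC-homo-+ a b
  eval-cong ρ (con-* a b)               = ratC-homo-* a b

module _ where
  open ℚᵘP.≃-Reasoning

  /1-homo-+ : ∀ a b → (a ℤ.+ b) ℚ./ 1 ≡ a ℚ./ 1 ℚ.+ b ℚ./ 1
  /1-homo-+ a b = ℚP.toℚᵘ-injective (begin
    ℚ.toℚᵘ ((a ℤ.+ b) ℚ./ 1)                  ≈⟨ ℚP.toℚᵘ-fromℚᵘ (ℚᵘ.mkℚᵘ (a ℤ.+ b) 0) ⟩
    ℚᵘ.mkℚᵘ (a ℤ.+ b) 0                       ≈⟨ ℚᵘ.*≡* (≡.cong (ℤ._* + 1) (≡.sym
                                                   (≡.cong₂ ℤ._+_ (ℤP.*-identityʳ a) (ℤP.*-identityʳ b)))) ⟩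
    ℚᵘ.mkℚᵘ a 0 ℚᵘ.+ ℚᵘ.mkℚᵘ b 0              ≈⟨ ℚᵘP.+-cong (ℚP.toℚᵘ-fromℚᵘ (ℚᵘ.mkℚᵘ a 0))
                                                               (ℚP.toℚᵘ-fromℚᵘ (ℚᵘ.mkℚᵘ b 0)) ⟨
    ℚ.toℚᵘ (a ℚ./ 1) ℚᵘ.+ ℚ.toℚᵘ (b ℚ./ 1)    ≈⟨ ℚP.toℚᵘ-homo-+ (a ℚ./ 1) (b ℚ./ 1) ⟨
    ℚ.toℚᵘ (a ℚ./ 1 ℚ.+ b ℚ./ 1)              ∎)

  clear-denominator : ∀ q m k → ℚ.toℚᵘ q ℚᵘ.≃ ℚᵘ.mkℚᵘ m k → (+ suc k ℚ./ 1) ℚ.* q ≡ m ℚ./ 1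
  clear-denominator q m k q≃m/k = ℚP.toℚᵘ-injective (begin
    ℚ.toℚᵘ ((+ suc k ℚ./ 1) ℚ.* q)             ≈⟨ ℚP.toℚᵘ-homo-* (+ suc k ℚ./ 1) q ⟩
    ℚ.toℚᵘ (+ suc k ℚ./ 1) ℚᵘ.* ℚ.toℚᵘ q       ≈⟨ ℚᵘP.*-cong (ℚP.toℚᵘ-fromℚᵘ (ℚᵘ.mkℚᵘ (+ suc k) 0)) q≃m/k ⟩
    ℚᵘ.mkℚᵘ (+ suc k) 0 ℚᵘ.* ℚᵘ.mkℚᵘ m k       ≈⟨ ℚᵘ.*≡* (≡.trans (ℤP.*-identityʳ _) (≡.trans (ℤP.*-comm (+ suc k) m)
                                                   (≡.cong (λ w → m ℤ.* + suc w) (≡.sym (ℕP.+-identityʳ k))))) ⟩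
    ℚᵘ.mkℚᵘ m 0                                ≈⟨ ℚP.toℚᵘ-fromℚᵘ (ℚᵘ.mkℚᵘ m 0) ⟨
    ℚ.toℚᵘ (m ℚ./ 1)                           ∎)

module PolynomialRing {X : Set} where

  ≈ₚ-isCommutativeRing : IsCommutativeRing (_≈ₚ_ {X}) _⊕_ _⊗_ ⊝_ 𝟘 𝟙
  ≈ₚ-isCommutativeRing = record
    { isRing = record
      { +-isAbelianGroup = record
        { isGroup = record
          { isMonoid = record
            { isSemigroup = record
              { isMagma = record
                { isEquivalence = record { refl = ≈refl ; sym = ≈sym ; trans = ≈trans }
                ; ∙-cong = ⊕-cong }
              ; assoc = ⊕-assoc }
            ; identity = ⊕-idˡ , λ p → ≈trans (⊕-comm p 𝟘) (⊕-idˡ p) }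
          ; inverse = (λ p → ≈trans (⊕-comm (⊝ p) p) (⊕-invʳ p)) , ⊕-invʳ
          ; ⁻¹-cong = ⊝-cong }
        ; comm = ⊕-comm }
      ; *-cong = ⊗-cong
      ; *-assoc = ⊗-assoc
      ; *-identity = ⊗-idˡ , λ p → ≈trans (⊗-comm p 𝟙) (⊗-idˡ p)
      ; distrib = ⊗-distribˡ-⊕ , λ p q r →
          ≈trans (⊗-comm (q ⊕ r) p) (≈trans (⊗-distribˡ-⊕ p q r) (⊕-cong (⊗-comm p q) (⊗-comm p r))) }
    ; *-comm = ⊗-comm }

  -- Only the ring reduct and the constants 1/n of this structure are ever used.
  𝔓 : Structure
  𝔓 = record
    { Carrier = Poly X
    ; _≈_     = _≈ₚ_
    ; _+_     = _⊕_
    ; _*_     = _⊗_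
    ; -_      = ⊝_
    ; 0#      = 𝟘
    ; 1#      = 𝟙
    ; _≤_     = λ _ _ → ⊤
    ; Int     = λ _ → ⊤
    ; inv     = λ n → con (+ 1 ℚ./ suc n)
    }

  open Structure 𝔓 using (natC; intC; ratC; sumN; inv; eval)
  private module N = Numerals 𝔓 ≈ₚ-isCommutativeRing

  con-cong : ∀ {p q : ℚ.ℚ} → p ≡ q → con {X} p ≈ₚ con q
  con-cong ≡.refl = ≈refl

  cℤ-homo-+ : ∀ a b → cℤ {X} (a ℤ.+ b) ≈ₚ cℤ a ⊕ cℤ b
  cℤ-homo-+ a b = ≈trans (con-cong (/1-homo-+ a b)) (con-+ (a ℚ./ 1) (b ℚ./ 1))

  cℤ-homo-neg : ∀ z → cℤ {X} (ℤ.- z) ≈ₚ ⊝ cℤ z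
  cℤ-homo-neg z = N.+-inverseʳ-unique (cℤ z) (cℤ (ℤ.- z))
    (≈trans (≈sym (cℤ-homo-+ z (ℤ.- z))) (con-cong (≡.cong (λ w → w ℚ./ 1) (ℤP.+-inverseʳ z))))

  natC≈cℤ : ∀ n → natC n ≈ₚ cℤ (+ n)
  natC≈cℤ zero    = ≈refl
  natC≈cℤ (suc n) = ≈sym (≈trans (cℤ-homo-+ (+ 1) (+ n)) (⊕-cong ≈refl (≈sym (natC≈cℤ n))))

  intC≈cℤ : ∀ z → intC z ≈ₚ cℤ z
  intC≈cℤ (+ n)    = natC≈cℤ n
  intC≈cℤ -[1+ n ] = ≈trans (⊝-cong (natC≈cℤ (suc n))) (≈sym (cℤ-homo-neg (+ suc n)))

  natC*con≈intC : ∀ q m k → ℚ.toℚᵘ q ℚᵘ.≃ ℚᵘ.mkℚᵘ m k → natC (suc k) ⊗ con q ≈ₚ intC m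
  natC*con≈intC q m k q≃m/k = begin
    natC (suc k) ⊗ con q           ≈⟨ ⊗-cong (natC≈cℤ (suc k)) ≈refl ⟩
    cℤ (+ suc k) ⊗ con q           ≈⟨ con-* (+ suc k ℚ./ 1) q ⟨
    con ((+ suc k ℚ./ 1) ℚ.* q)    ≈⟨ con-cong (clear-denominator q m k q≃m/k) ⟩
    cℤ m                           ≈⟨ intC≈cℤ m ⟨
    intC m                         ∎
    where open SetoidReasoning N.setoid

  natC*inv≈𝟙 : ∀ n → natC (suc n) ⊗ inv n ≈ₚ 𝟙
  natC*inv≈𝟙 n = ≈trans (natC*con≈intC (+ 1 ℚ./ suc n) (+ 1) n (ℚP.toℚᵘ-fromℚᵘ (ℚᵘ.mkℚᵘ (+ 1) n))) (N.+-identityʳ 𝟙)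

  sumN-inv≈𝟙 : ∀ n → sumN n (inv n) ≈ₚ 𝟙
  sumN-inv≈𝟙 n = ≈trans (N.sumN≈natC* n (inv n)) (natC*inv≈𝟙 n)

  module ℚ[X] = Rationals 𝔓 ≈ₚ-isCommutativeRing sumN-inv≈𝟙

  ratC≈con : ∀ q → ratC q ≈ₚ con q
  ratC≈con q@(ℚ.mkℚ a d _) =
    ℚ[X].natC-cancelˡ d (≈trans (ℚ[X].natC*ratC≈intC q a d ℚᵘP.≃-refl) (≈sym (natC*con≈intC q a d ℚᵘP.≃-refl)))

  eval-var : ∀ p → eval var p ≈ₚ p
  eval-var (con q) = ratC≈con q
  eval-var (var x) = ≈refl
  eval-var (p ⊕ q) = ⊕-cong (eval-var p) (eval-var q)
  eval-var (p ⊗ q) = ⊗-cong (eval-var p) (eval-var q)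
  eval-var (⊝ p)   = ⊝-cong (eval-var p)

  ⊖𝟘 : ∀ {p} → p ⊖ 𝟘 ≈ₚ p
  ⊖𝟘 {p} = ≈trans (⊕-cong ≈refl ℚ[X].-0#≈0#) (ℚ[X].+-identityʳ p)

module Quotient {X : Set} (I : Poly X → Set) (isIdeal : IsIdeal I) where
  open IsIdeal isIdeal
  open PolynomialRing.ℚ[X] {X} using (solve; _:=_; _:+_; _:*_; :-_)

  infix 4 _≈ᴵ_
  _≈ᴵ_ : Poly X → Poly X → Set
  p ≈ᴵ q = I (p ⊖ q)

  ≈ₚ⇒≈ᴵ : ∀ {p q} → p ≈ₚ q → p ≈ᴵ q
  ≈ₚ⇒≈ᴵ {p} {q} p≈q = resp (≈sym (≈trans (⊕-cong p≈q ≈refl) (⊕-invʳ q))) zero∈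

  ≈ᴵ-refl : ∀ {p} → p ≈ᴵ p
  ≈ᴵ-refl = ≈ₚ⇒≈ᴵ ≈refl

  ≈ᴵ-sym : ∀ {p q} → p ≈ᴵ q → q ≈ᴵ p
  ≈ᴵ-sym {p} {q} p≈q = resp (solve 2 (λ p q → :- (p :+ :- q) := q :+ :- p) ≈refl p q) (neg p≈q)

  ≈ᴵ-trans : ∀ {p q r} → p ≈ᴵ q → q ≈ᴵ r → p ≈ᴵ r
  ≈ᴵ-trans {p} {q} {r} p≈q q≈r =
    resp (solve 3 (λ p q r → (p :+ :- q) :+ (q :+ :- r) := p :+ :- r) ≈refl p q r) (add p≈q q≈r)

  ⊕-congᴵ : ∀ {p p′ q q′} → p ≈ᴵ p′ → q ≈ᴵ q′ → p ⊕ q ≈ᴵ p′ ⊕ q′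
  ⊕-congᴵ {p} {p′} {q} {q′} p≈p′ q≈q′ =
    resp (solve 4 (λ p p′ q q′ → (p :+ :- p′) :+ (q :+ :- q′) := (p :+ q) :+ :- (p′ :+ q′)) ≈refl p p′ q q′)
         (add p≈p′ q≈q′)

  ⊗-congᴵ : ∀ {p p′ q q′} → p ≈ᴵ p′ → q ≈ᴵ q′ → p ⊗ q ≈ᴵ p′ ⊗ q′
  ⊗-congᴵ {p} {p′} {q} {q′} p≈p′ q≈q′ =
    resp (solve 4 (λ p p′ q q′ → q :* (p :+ :- p′) :+ p′ :* (q :+ :- q′) := (p :* q) :+ :- (p′ :* q′)) ≈refl p p′ q q′)
         (add (mul q p≈p′) (mul p′ q≈q′))

  ⊝-congᴵ : ∀ {p p′} → p ≈ᴵ p′ → ⊝ p ≈ᴵ ⊝ p′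
  ⊝-congᴵ {p} {p′} p≈p′ = resp (solve 2 (λ p p′ → :- (p :+ :- p′) := (:- p) :+ :- (:- p′)) ≈refl p p′) (neg p≈p′)

  ≈ᴵ-isCommutativeRing : IsCommutativeRing _≈ᴵ_ _⊕_ _⊗_ ⊝_ 𝟘 𝟙
  ≈ᴵ-isCommutativeRing = record
    { isRing = record
      { +-isAbelianGroup = record
        { isGroup = record
          { isMonoid = record
            { isSemigroup = record
              { isMagma = record
                { isEquivalence = record { refl = ≈ᴵ-refl ; sym = ≈ᴵ-sym ; trans = ≈ᴵ-trans }
                ; ∙-cong = ⊕-congᴵ }
              ; assoc = λ p q r → ≈ₚ⇒≈ᴵ (R.+-assoc p q r) }
            ; identity = (λ p → ≈ₚ⇒≈ᴵ (R.+-identityˡ p)) , (λ p → ≈ₚ⇒≈ᴵ (R.+-identityʳ p)) }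
          ; inverse = (λ p → ≈ₚ⇒≈ᴵ (R.-‿inverseˡ p)) , (λ p → ≈ₚ⇒≈ᴵ (R.-‿inverseʳ p))
          ; ⁻¹-cong = ⊝-congᴵ }
        ; comm = λ p q → ≈ₚ⇒≈ᴵ (R.+-comm p q) }
      ; *-cong = ⊗-congᴵ
      ; *-assoc = λ p q r → ≈ₚ⇒≈ᴵ (R.*-assoc p q r)
      ; *-identity = (λ p → ≈ₚ⇒≈ᴵ (R.*-identityˡ p)) , (λ p → ≈ₚ⇒≈ᴵ (R.*-identityʳ p))
      ; distrib = (λ p q r → ≈ₚ⇒≈ᴵ (R.distribˡ p q r)) , (λ p q r → ≈ₚ⇒≈ᴵ (R.distribʳ p q r)) }
    ; *-comm = λ p q → ≈ₚ⇒≈ᴵ (R.*-comm p q) }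
    where module R = PolynomialRing.ℚ[X] {X}

module _ {X : Set} {B : List (Poly X)} where
  open PolynomialRing {X} using (cℤ-homo-neg)
  open PolynomialRing.ℚ[X] {X} using (solve; _:=_; _:+_; _:*_; :-_; -0#≈0#; +-identityʳ)

  ℤSpan-+ : ∀ {v w} → ℤSpan B v → ℤSpan B w → ∃[ s ] (ℤSpan B s × s ≈ₚ v ⊕ w)
  ℤSpan-+ {w = w} zero sw = w , sw , ≈sym (⊕-idˡ w)
  ℤSpan-+ {w = w} (step k b∈B sv) sw with ℤSpan-+ sv sw
  ... | s , ss , s≈v+w = _ , step k b∈B ss , ≈trans (⊕-cong ≈refl s≈v+w) (≈sym (⊕-assoc _ _ _))

  ℤSpan-neg : ∀ {v} → ℤSpan B v → ∃[ s ] (ℤSpan B s × s ≈ₚ ⊝ v)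
  ℤSpan-neg zero = 𝟘 , zero , ≈sym -0#≈0#
  ℤSpan-neg (step {b} {v} k b∈B sv) with ℤSpan-neg sv
  ... | s , ss , s≈-v = _ , step (ℤ.- k) b∈B ss ,
    ≈trans (⊕-cong (⊗-cong (cℤ-homo-neg k) ≈refl) s≈-v)
           (solve 3 (λ k b v → (:- k) :* b :+ :- v := :- (k :* b :+ v)) ≈refl (cℤ k) b v)

  unitsPlusSpan-mono : ∀ {C C′ : Poly X → Set} → (∀ {p} → units C p → units C′ p) →
                       ∀ {p} → unitsPlusSpan C B p → unitsPlusSpan C′ B p
  unitsPlusSpan-mono C⊆C′ (u , v , u∈I , sv , p≈u+v) = u , v , C⊆C′ u∈I , sv , p≈u+v

  module _ (C : Poly X → Set) (unitsIdeal : IsIdeal (units C)) where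
    open IsIdeal unitsIdeal

    unitsPlusSpan-+ : ∀ {p q} → unitsPlusSpan C B p → unitsPlusSpan C B q → unitsPlusSpan C B (p ⊕ q)
    unitsPlusSpan-+ (u₁ , v₁ , u₁∈I , sv₁ , p≈) (u₂ , v₂ , u₂∈I , sv₂ , q≈) with ℤSpan-+ sv₁ sv₂
    ... | s , ss , s≈v₁+v₂ = u₁ ⊕ u₂ , s , add u₁∈I u₂∈I , ss ,
      ≈trans (⊕-cong p≈ q≈)
        (≈trans (solve 4 (λ a b c d → (a :+ b) :+ (c :+ d) := (a :+ c) :+ (b :+ d)) ≈refl u₁ v₁ u₂ v₂)
                (⊕-cong ≈refl (≈sym s≈v₁+v₂)))

    unitsPlusSpan-neg : ∀ {p} → unitsPlusSpan C B p → unitsPlusSpan C B (⊝ p)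
    unitsPlusSpan-neg (u , v , u∈I , sv , p≈u+v) with ℤSpan-neg sv
    ... | s , ss , s≈-v = ⊝ u , s , neg u∈I , ss ,
      ≈trans (⊝-cong p≈u+v)
        (≈trans (solve 2 (λ a b → :- (a :+ b) := (:- a) :+ (:- b)) ≈refl u v) (⊕-cong ≈refl (≈sym s≈-v)))

    unitsPlusSpan-∈ : ∀ {b} → b ∈ B → unitsPlusSpan C B b
    unitsPlusSpan-∈ {b} b∈B = 𝟘 , cℤ (+ 1) ⊗ b ⊕ 𝟘 , zero∈ , step (+ 1) b∈B zero ,
      ≈sym (≈trans (⊕-idˡ _) (≈trans (+-identityʳ _) (⊗-idˡ b)))

-- The canonical structure 𝔐(C, L)

module TermModel {X : Set} (C L : Poly X → Set) where
  open PolynomialRing {X} using (𝔓; eval-var)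
  private
    module 𝔓 = Structure 𝔓
    module 𝔐 = Structure (𝔐 C L)

  𝔐-sumN : ∀ n x → 𝔐.sumN n x ≈ₚ 𝔓.sumN n x
  𝔐-sumN zero    x = ≈refl
  𝔐-sumN (suc n) x = ⊕-cong ≈refl (𝔐-sumN n x)

  𝔐-natC : ∀ n → 𝔐.natC n ≈ₚ 𝔓.natC n
  𝔐-natC zero    = ≈refl
  𝔐-natC (suc n) = ⊕-cong ≈refl (𝔐-natC n)

  𝔐-intC : ∀ z → 𝔐.intC z ≈ₚ 𝔓.intC z
  𝔐-intC (+ n)    = 𝔐-natC n
  𝔐-intC -[1+ n ] = ⊝-cong (𝔐-natC (suc n))

  𝔐-eval-var : ∀ p → 𝔐.eval var p ≈ₚ p
  𝔐-eval-var p = ≈trans (eval-𝔐≈eval-𝔓 p) (eval-var p)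
    where
    eval-𝔐≈eval-𝔓 : ∀ p → 𝔐.eval var p ≈ₚ 𝔓.eval var p
    eval-𝔐≈eval-𝔓 (con (ℚ.mkℚ a d _)) = ⊗-cong (𝔐-intC a) ≈refl
    eval-𝔐≈eval-𝔓 (var x) = ≈refl
    eval-𝔐≈eval-𝔓 (p ⊕ q) = ⊕-cong (eval-𝔐≈eval-𝔓 p) (eval-𝔐≈eval-𝔓 q)
    eval-𝔐≈eval-𝔓 (p ⊗ q) = ⊗-cong (eval-𝔐≈eval-𝔓 p) (eval-𝔐≈eval-𝔓 q)
    eval-𝔐≈eval-𝔓 (⊝ p)   = ⊝-cong (eval-𝔐≈eval-𝔓 p)

𝟙∈ideal⇒total : ∀ {X : Set} {I : Poly X → Set} → IsIdeal I → I 𝟙 → ∀ p → I p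
𝟙∈ideal⇒total {X} isIdeal 𝟙∈I p = resp (PolynomialRing.ℚ[X].*-identityʳ {X} p) (mul p 𝟙∈I)
  where open IsIdeal isIdeal

module RegularCone {X : Set} (C : Poly X → Set) (regular : IsRegular C) where
  open PolynomialRing {X} using (⊖𝟘)
  open PolynomialRing.ℚ[X] {X} using (solve; _:=_; _:+_; :-_)
  open IsRegular regular
  open IsCone isCone
  open Quotient (units C) unitsIdeal public

  resp-≈ᴵ : ∀ {p q} → p ≈ᴵ q → C p → C q
  resp-≈ᴵ {p} {q} p≈q p∈C = resp (solve 2 (λ p q → p :+ :- (p :+ :- q) := q) ≈refl p q) (add p∈C (proj₂ p≈q))

  module CanonicalValuation (L : Poly X → Set) where
    private module 𝔐 = Structure (𝔐 C L)
    open TermModel C L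

    eval-var≈ᴵ : ∀ p → 𝔐.eval var p ≈ᴵ p
    eval-var≈ᴵ p = ≈ₚ⇒≈ᴵ (𝔐-eval-var p)

    0≤-var⇔ : ∀ p → 𝔐.0# 𝔐.≤ 𝔐.eval var p ⇔ C p
    0≤-var⇔ p = mk⇔ (resp e) (resp (≈sym e))
      where e = ≈trans ⊖𝟘 (𝔐-eval-var p)

    0≈-var⇒ : ∀ p → 𝔐.0# 𝔐.≈ 𝔐.eval var p → units C p
    0≈-var⇒ p 0≈p = IsIdeal.resp unitsIdeal ⊖𝟘 (≈ᴵ-trans (≈ᴵ-sym (eval-var≈ᴵ p)) (≈ᴵ-sym 0≈p))

    Int-var⇔ : ∀ p → 𝔐.Int (𝔐.eval var p) ⇔ 𝔐.Int p
    Int-var⇔ p = mk⇔ (λ (q , q∈L , e≈q) → q , q∈L , ≈ᴵ-trans (≈ᴵ-sym (eval-var≈ᴵ p)) e≈q)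
                     (λ (q , q∈L , p≈q) → q , q∈L , ≈ᴵ-trans (eval-var≈ᴵ p) p≈q)

module CanonicalModel {X : Set} (C : Poly X → Set) (regular : IsRegular C) (consistent : Consistent C)
  (B : List (Poly X)) (𝟙∈B : 𝟙 ∈ B) (closedCP : ClosedCP C (unitsPlusSpan C B)) where

  open PolynomialRing {X}
  open ℚ[X] using (solve; _:=_; _:+_; :-_; sumN≈natC*)
  open Structure 𝔓 using (natC; intC; inv)
  open IsRegular regular
  open IsCone isCone
  open RegularCone C regular
  private
    module I = IsIdeal unitsIdeal
    L : Poly X → Set
    L = unitsPlusSpan C B
    module 𝔐 = Structure (𝔐 C L)
  open TermModel C L

  cancel-sumN : ∀ n {p} → C (𝔐.sumN n p) → C p
  cancel-sumN n {p} np∈C = resp (begin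
      inv n ⊗ 𝔐.sumN n p             ≈⟨ ⊗-cong ≈refl (≈trans (𝔐-sumN n p) (sumN≈natC* n p)) ⟩
      inv n ⊗ (natC (suc n) ⊗ p)     ≈⟨ x∙yz≈yx∙z (inv n) (natC (suc n)) p ⟩
      (natC (suc n) ⊗ inv n) ⊗ p     ≈⟨ ⊗-cong (natC*inv≈𝟙 n) ≈refl ⟩
      𝟙 ⊗ p                          ≈⟨ ⊗-idˡ p ⟩
      p                              ∎)
    (scale (+ 1 ℚ./ suc n) (ℚP.nonNegative⁻¹ _ {{ℚP.normalize-nonNeg 1 (suc n)}}) np∈C)
    where
    open SetoidReasoning ℚ[X].setoid
    open CommSemigroupProperties ℚ[X].*-commutativeSemigroup using (x∙yz≈yx∙z)

  cutting-plane : ∀ k m {p} → 𝔐.Int p → C (𝔐.sumN k p ⊕ 𝔐.intC m) → C (p ⊕ 𝔐.intC (ℚ.floor (m ℚ./ suc k)))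
  cutting-plane k m {p} (q , q∈L , p≈q) kp+m∈C =
    resp-≈ᴵ (⊕-congᴵ (≈ᴵ-sym p≈q) (≈ₚ⇒≈ᴵ (≈sym (𝔐-intC≈cℤ (ℚ.floor (m ℚ./ suc k))))))
      (closedCP k m q q∈L
        (resp-≈ᴵ (⊕-congᴵ (⊗-congᴵ ≈ᴵ-refl p≈q) ≈ᴵ-refl) (resp (⊕-cong 𝔐-sumN≈cℤ* (𝔐-intC≈cℤ m)) kp+m∈C)))
    where
    𝔐-intC≈cℤ : ∀ z → 𝔐.intC z ≈ₚ cℤ z
    𝔐-intC≈cℤ z = ≈trans (𝔐-intC z) (intC≈cℤ z)
    𝔐-sumN≈cℤ* : 𝔐.sumN k p ≈ₚ cℤ (+ suc k) ⊗ p
    𝔐-sumN≈cℤ* = ≈trans (𝔐-sumN k p) (≈trans (sumN≈natC* k p) (⊗-cong (natC≈cℤ (suc k)) ≈refl))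

  isLIRR : IsLIRR (𝔐 C L)
  isLIRR = record
    { isCommutativeRing = ≈ᴵ-isCommutativeRing
    ; ≤-respˡ   = λ x≈x′ → resp-≈ᴵ (⊕-congᴵ ≈ᴵ-refl (⊝-congᴵ x≈x′))
    ; ≤-respʳ   = λ y≈y′ → resp-≈ᴵ (⊕-congᴵ y≈y′ ≈ᴵ-refl)
    ; Int-resp  = λ { x≈x′ (p , p∈L , x≈p) → p , p∈L , ≈ᴵ-trans (≈ᴵ-sym x≈x′) x≈p }
    ; ≤-refl    = λ x → proj₁ (≈ᴵ-refl {x})
    ; ≤-trans   = λ {x} {y} {z} x≤y y≤z →
        resp (solve 3 (λ x y z → (y :+ :- x) :+ (z :+ :- y) := z :+ :- x) ≈refl x y z) (add x≤y y≤z)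
    ; ≤-antisym = λ {x} {y} x≤y y≤x → y≤x , resp (solve 2 (λ x y → y :+ :- x := :- (x :+ :- y)) ≈refl x y) x≤y
    ; ≤-+       = λ {x} {y} z → resp (solve 3 (λ x y z → y :+ :- x := (y :+ z) :+ :- (x :+ z)) ≈refl x y z)
    ; 0≤1       = resp (≈sym ⊖𝟘) one∈
    ; 0≉1       = λ 0≈1 → consistent λ p → proj₁ (𝟙∈ideal⇒total unitsIdeal (I.resp ⊖𝟘 (≈ᴵ-sym 0≈1)) p)
    ; inv-spec  = λ n → ≈ₚ⇒≈ᴵ (≈trans (𝔐-sumN n _) (sumN-inv≈𝟙 n))
    ; div-pos   = λ n x nx≥0 → resp (≈sym ⊖𝟘) (cancel-sumN n (resp ⊖𝟘 nx≥0))
    ; Int-1     = 𝟙 , unitsPlusSpan-∈ C unitsIdeal 𝟙∈B , ≈ᴵ-refl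
    ; Int-+     = λ { (p , p∈L , x≈p) (q , q∈L , y≈q) →
        p ⊕ q , unitsPlusSpan-+ C unitsIdeal p∈L q∈L , ⊕-congᴵ x≈p y≈q }
    ; Int-neg   = λ { {x} {y} (p , p∈L , x≈p) x+y≈0 → ⊝ p , unitsPlusSpan-neg C unitsIdeal p∈L ,
        I.resp (solve 3 (λ x y p → (x :+ y) :+ :- (x :+ :- p) := y :+ :- (:- p)) ≈refl x y p)
               (I.add (I.resp ⊖𝟘 x+y≈0) (I.neg x≈p)) }
    ; Int-cut   = λ k m x x∈Int kx+m≥0 → resp (≈sym ⊖𝟘) (cutting-plane k m x∈Int (resp ⊖𝟘 kx+m≥0))
    }

-- Models of LIRR and their positive cones

module LIRRProperties (𝔄 : Structure) (lirr : IsLIRR 𝔄) where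
  open Structure 𝔄 using (_≤_; Int; natC; intC; inv; sumN)
  open IsLIRR lirr
  open Rationals 𝔄 isCommutativeRing inv-spec public

  0≤-+ : ∀ {x y} → 0# ≤ x → 0# ≤ y → 0# ≤ (x + y)
  0≤-+ {x} {y} 0≤x 0≤y = ≤-trans 0≤y (≤-respˡ (+-identityˡ y) (≤-+ y 0≤x))

  0≤-natC* : ∀ n {x} → 0# ≤ x → 0# ≤ (natC n * x)
  0≤-natC* zero    {x} 0≤x = ≤-respʳ (sym (zeroˡ x)) (≤-refl 0#)
  0≤-natC* (suc n) {x} 0≤x = ≤-respʳ (trans (+-congʳ (sym (*-identityˡ x))) (sym (distribʳ _ _ _)))
                                     (0≤-+ 0≤x (0≤-natC* n 0≤x))

  0≤-inv* : ∀ d {x} → 0# ≤ x → 0# ≤ (inv d * x)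
  0≤-inv* d {x} 0≤x = div-pos d (inv d * x) (≤-respʳ (sym sumN[inv*x]≈x) 0≤x)
    where
    sumN[inv*x]≈x : sumN d (inv d * x) ≈ x
    sumN[inv*x]≈x = begin
      sumN d (inv d * x)             ≈⟨ sumN≈natC* d _ ⟩
      natC (suc d) * (inv d * x)     ≈⟨ *-assoc _ _ _ ⟨
      (natC (suc d) * inv d) * x     ≈⟨ *-congʳ (natC*inv≈1 d) ⟩
      1# * x                         ≈⟨ *-identityˡ x ⟩
      x                              ∎

  ≤-antisym-0 : ∀ {x} → 0# ≤ x → 0# ≤ (- x) → x ≈ 0#
  ≤-antisym-0 {x} 0≤x 0≤-x = ≤-antisym (≤-respʳ (-‿inverseˡ x) (≤-respˡ (+-identityˡ x) (≤-+ x 0≤-x))) 0≤x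

  Int-0 : Int 0#
  Int-0 = Int-resp (-‿inverseʳ 1#) (Int-+ Int-1 (Int-neg Int-1 (-‿inverseʳ 1#)))

  Int-natC* : ∀ n {x} → Int x → Int (natC n * x)
  Int-natC* zero    {x} _    = Int-resp (sym (zeroˡ x)) Int-0
  Int-natC* (suc n) {x} Intx = Int-resp (trans (+-congʳ (sym (*-identityˡ x))) (sym (distribʳ _ _ _)))
                                        (Int-+ Intx (Int-natC* n Intx))

  Int-intC* : ∀ z {x} → Int x → Int (intC z * x)
  Int-intC* (+ n)    Intx = Int-natC* n Intx
  Int-intC* -[1+ n ] {x} Intx = Int-neg (Int-natC* (suc n) Intx)
    (trans (sym (distribʳ x _ _)) (trans (*-congʳ (-‿inverseʳ _)) (zeroˡ x)))

module PositiveCone (𝔄 : Structure) (lirr : IsLIRR 𝔄) {X : Set} (ρ : X → Structure.Carrier 𝔄) where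
  open Structure 𝔄 using (_≤_; Int; natC; inv; sumN; ratC)
  open IsLIRR lirr
  open LIRRProperties 𝔄 lirr

  ⟦_⟧ : Poly X → Structure.Carrier 𝔄
  ⟦_⟧ = Structure.eval 𝔄 ρ

  C⁺ : Poly X → Set
  C⁺ p = 0# ≤ ⟦ p ⟧

  units-C⁺⇒≈0 : ∀ p → units C⁺ p → ⟦ p ⟧ ≈ 0#
  units-C⁺⇒≈0 p (0≤p , 0≤-p) = ≤-antisym-0 0≤p 0≤-p

  ≈0⇒units-C⁺ : ∀ p → ⟦ p ⟧ ≈ 0# → units C⁺ p
  ≈0⇒units-C⁺ p p≈0 = ≤-respʳ (sym p≈0) (≤-refl 0#) , ≤-respʳ (sym (trans (-‿cong p≈0) -0#≈0#)) (≤-refl 0#)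

  C⁺-isRegular : IsRegular C⁺
  C⁺-isRegular = record
    { isCone = record
      { resp  = λ p≈q → ≤-respʳ (eval-cong ρ p≈q)
      ; zero∈ = ≤-respʳ (sym ratC-0) (≤-refl 0#)
      ; add   = 0≤-+
      ; scale = scale }
    ; one∈ = ≤-respʳ (sym ratC-1) 0≤1
    ; unitsIdeal = record
      { resp  = λ {p} {q} p≈q p∈I → ≈0⇒units-C⁺ q (trans (sym (eval-cong ρ p≈q)) (units-C⁺⇒≈0 p p∈I))
      ; zero∈ = ≈0⇒units-C⁺ 𝟘 ratC-0
      ; add   = λ {p} {q} p∈I q∈I →
          ≈0⇒units-C⁺ (p ⊕ q) (trans (+-cong (units-C⁺⇒≈0 p p∈I) (units-C⁺⇒≈0 q q∈I)) (+-identityˡ 0#))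
      ; neg   = λ {p} p∈I → ≈0⇒units-C⁺ (⊝ p) (trans (-‿cong (units-C⁺⇒≈0 p p∈I)) -0#≈0#)
      ; mul   = λ q {p} p∈I → ≈0⇒units-C⁺ (q ⊗ p) (trans (*-congˡ (units-C⁺⇒≈0 p p∈I)) (zeroʳ _)) } }
    where
    scale : ∀ c {p} → ℚ.0ℚ ℚ.≤ c → C⁺ p → C⁺ (con c ⊗ p)
    scale (ℚ.mkℚ (+ n) d _) {p} _ 0≤p =
      ≤-respʳ (sym (*-assoc (natC n) (inv d) ⟦ p ⟧)) (0≤-natC* n (0≤-inv* d 0≤p))
    scale (ℚ.mkℚ -[1+ n ] d _) (ℚ.*≤* ()) 0≤p

  C⁺-consistent : Consistent C⁺
  C⁺-consistent C⁺-total = 0≉1 (trans (sym (≤-antisym-0 (C⁺-total 𝟙) (C⁺-total (⊝ 𝟙)))) ratC-1)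

  module _ {B : List (Poly X)} (B-Int : All (λ b → Int ⟦ b ⟧) B) where

    ℤSpan-Int : ∀ {v} → ℤSpan B v → Int ⟦ v ⟧
    ℤSpan-Int zero                = Int-resp (sym ratC-0) Int-0
    ℤSpan-Int (step k b∈B sv) =
      Int-+ (Int-resp (*-congʳ (sym (ratC-fromℤ k))) (Int-intC* k (All.lookup B-Int b∈B))) (ℤSpan-Int sv)

    unitsPlusSpan-Int : ∀ {p} → unitsPlusSpan C⁺ B p → Int ⟦ p ⟧
    unitsPlusSpan-Int (u , v , u∈I , sv , p≈u+v) =
      Int-resp (sym (trans (eval-cong ρ p≈u+v) (trans (+-congʳ (units-C⁺⇒≈0 u u∈I)) (+-identityˡ _))))
               (ℤSpan-Int sv)

    C⁺-closedCP : ClosedCP C⁺ (unitsPlusSpan C⁺ B)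
    C⁺-closedCP k m p p∈L kp+m≥0 =
      ≤-respʳ (+-congˡ (sym (ratC-fromℤ (ℚ.floor (m ℚ./ suc k)))))
        (Int-cut k m ⟦ p ⟧ (unitsPlusSpan-Int p∈L) (≤-respʳ (+-cong kp≈sumN (ratC-fromℤ m)) kp+m≥0))
      where
      kp≈sumN : ratC (+ suc k ℚ./ 1) * ⟦ p ⟧ ≈ sumN k ⟦ p ⟧
      kp≈sumN = trans (*-congʳ (ratC-fromℤ (+ suc k))) (sym (sumN≈natC* k ⟦ p ⟧))

module FromModel {X : Set} (P Q R S T : List (Poly X)) (C : Poly X → Set) (least : IsLeastCone P (𝟙 ∷ S) C)
  (𝔄 : Structure) (lirr : IsLIRR 𝔄) (ρ : X → Structure.Carrier 𝔄) (sat : 𝔄 , ρ ⊨ mkF P Q R S T) where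

  open Structure 𝔄 using (Int)
  open IsLIRR lirr using (Int-1; Int-resp)
  open LIRRProperties 𝔄 lirr using (sym; ratC-1; x∙y⁻¹≈ε⇒x≈y)
  open PositiveCone 𝔄 lirr ρ

  private
    L : Poly X → Set
    L = unitsPlusSpan C (𝟙 ∷ S)
    module 𝔐 = Structure (𝔐 C L)

    regular : IsRegular C
    regular = proj₁ (proj₁ least)

  open RegularCone C regular
  open CanonicalValuation L

  B-Int : All (λ b → Int ⟦ b ⟧) (𝟙 ∷ S)
  B-Int = Int-resp (sym ratC-1) Int-1 All.∷ proj₁ (proj₂ (proj₂ (proj₂ sat)))

  C⊆C⁺ : ∀ {p} → C p → C⁺ p
  C⊆C⁺ {p} = proj₂ least C⁺ (C⁺-isRegular , proj₁ sat , C⁺-closedCP B-Int) p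

  units-C⊆units-C⁺ : ∀ {p} → units C p → units C⁺ p
  units-C⊆units-C⁺ (p∈C , -p∈C) = C⊆C⁺ p∈C , C⊆C⁺ -p∈C

  consistent : Consistent C
  consistent C-total = C⁺-consistent λ p → C⊆C⁺ (C-total p)

  𝔐-Int⇒Int : ∀ {p} → 𝔐.Int p → Int ⟦ p ⟧
  𝔐-Int⇒Int {p} (q , q∈L , p≈q) =
    Int-resp (sym (x∙y⁻¹≈ε⇒x≈y _ _ (units-C⁺⇒≈0 (p ⊖ q) (units-C⊆units-C⁺ p≈q))))
             (unitsPlusSpan-Int B-Int (unitsPlusSpan-mono units-C⊆units-C⁺ q∈L))

  canonical-⊨ : 𝔐 C L , var ⊨ mkF P Q R S T
  canonical-⊨ = let _ , Q≱0 , R≉0 , _ , T∉Int = sat in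
      All.map (λ {p} → Equivalence.from (0≤-var⇔ p)) (proj₁ (proj₂ (proj₁ least)))
    , All.map (λ {q} q≱0 0≤q → q≱0 (C⊆C⁺ (Equivalence.to (0≤-var⇔ q) 0≤q))) Q≱0
    , All.map (λ {r} r≉0 0≈r → r≉0 (sym (units-C⁺⇒≈0 r (units-C⊆units-C⁺ (0≈-var⇒ r 0≈r))))) R≉0
    , All.tabulate (λ {s} s∈S → Equivalence.from (Int-var⇔ s)
        (s , unitsPlusSpan-∈ C (IsRegular.unitsIdeal regular) (there s∈S) , ≈ᴵ-refl))
    , All.map (λ {t} t∉Int Int-t → t∉Int (𝔐-Int⇒Int (Equivalence.to (Int-var⇔ t) Int-t))) T∉Int

theorem4p2 : {X : Set} (P Q R S T : List (Poly X)) (C : Poly X → Set) →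
    IsLeastCone P (𝟙 ∷ S) C →
    (SatisfiableLIRR (mkF P Q R S T) ⇔
      (Consistent C × (𝔐 C (unitsPlusSpan C (𝟙 ∷ S)) , var ⊨ mkF P Q R S T)))
theorem4p2 P Q R S T C least@((regular , _ , closedCP) , _) = mk⇔
  (λ (𝔄 , lirr , ρ , sat) → let open FromModel P Q R S T C least 𝔄 lirr ρ sat in consistent , canonical-⊨)
  (λ (consistent , canonical-⊨) →
    𝔐 C (unitsPlusSpan C (𝟙 ∷ S)) , CanonicalModel.isLIRR C regular consistent (𝟙 ∷ S) (here ≡.refl) closedCP ,
    var , canonical-⊨)
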